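{- Fix integers $m\ge 1$ and $r\ge 0$. For every $k\ge -1$ and all $a,b,a',b'\in\mathbb{N}^{k+2}$: if $a'\le a$ and $b'\le b$ then $\mathrm{measure}_{(k)}(a',b')\le\mathrm{measure}_{(k)}(a,b)$; and if moreover $a'\ne a$ then $\mathrm{measure}_{(k)}(a',b')<\mathrm{measure}_{(k)}(a,b)$.
   Context: For vectors of $\mathbb{Z}^p$, $a\le b$ means $a_i\le b_i$ for all $i$. Given the fixed integers $m,r$ (in the paper, $m$ is the size of a fixed program $M$ and $r=\max_x n_x(M)$), $\mathrm{measure}_{(i)}:\mathbb{Z}^{i+2}\times\mathbb{Z}^{i+2}\to\mathbb{Z}$ is defined by $\mathrm{measure}_{(-1)}(a_0,b_0)=a_0$ and $\mathrm{measure}_{(i+1)}((a_0,\dots,a_{i+2}),(b_0,\dots,b_{i+2}))=\mathrm{measure}_{(i)}\big((a_1+(r+1)(b_1+a_0m)a_0,\dots,a_{i+2}+(r+1)(b_{i+2}+a_0m)a_0),\ (b_1+a_0m,\dots,b_{i+2}+a_0m)\big)$. -}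

module Defs where

open import Data.Nat using (ℕ; zero; suc)
open import Data.Integer using (ℤ; +_; _+_; _*_)
open import Data.Vec using (Vec; []; _∷_; map; zipWith)

-- measure m r n  corresponds to the paper's measure_(k) with n = k + 1,
-- taking two vectors of length n + 1 = k + 2 (integer entries).
measure : ℕ → ℕ → (n : ℕ) → Vec ℤ (suc n) → Vec ℤ (suc n) → ℤ
measure m r zero (a₀ ∷ []) (b₀ ∷ []) = a₀
measure m r (suc n) (a₀ ∷ as) (b₀ ∷ bs) =
  measure m r n
    (zipWith (λ aᵢ bᵢ → aᵢ + (+ (suc r)) * (bᵢ + a₀ * + m) * a₀) as bs)
    (map (λ bᵢ → bᵢ + a₀ * + m) bs)

module Submission where

-- All entries are natural numbers, so the integer-valued
-- measure is the image under +_ of a natural-number recursion measureℕ that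
-- applies, coordinate-wise, the two update maps of the definition:
--   b ↦ b + a₀·m          and          a ↦ a + (r+1)·(b + a₀·m)·a₀.
-- Both maps are monotone in all their arguments, and the a-update is strictly
-- monotone in a, and also in a₀ once m ≥ 1 (its last summand then has a
-- positive factor).  So one recursion step sends a pointwise-below pair to a
-- pointwise-below pair, and sends a strictly-below first vector (below
-- pointwise and different) to a strictly-below one: a strict decrease in a₀
-- becomes a strict decrease in the new head, a strict decrease in a later
-- coordinate survives in place.  Induction on the length gives monotonicity
-- and strict monotonicity of measureℕ; transporting along +_ gives lemma8.

open import Defs
open import Data.Nat using (ℕ; suc; _≥_)
open import Data.Integer using (+_) renaming (_≤_ to _≤ℤ_; _<_ to _<ℤ_)
open import Data.Vec using (Vec; map)
open import Data.Vec.Relation.Binary.Pointwise.Inductive using (Pointwise)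
open import Data.Nat using (_≤_)
open import Data.Product using (_×_)
open import Relation.Binary.PropositionalEquality using (_≢_)

open import Data.Nat using (zero; _+_; _*_; _<_; s≤s; z≤n; >-nonZero)
open import Data.Nat.Properties
  using (≤-trans; <⇒≤; m≤n⇒m<n∨m≡n; m≤n+m; m≤n*m;
         +-mono-≤; +-mono-<-≤; +-mono-≤-<; *-mono-≤; *-monoˡ-≤; *-monoʳ-≤; *-monoʳ-<;
         module ≤-Reasoning)
import Data.Integer as ℤ
open import Data.Integer.Properties using (pos-+; pos-*)
open import Data.Vec using ([]; _∷_; zipWith)
open import Data.Vec.Properties using (map-∘; map-cong)
open import Data.Vec.Relation.Binary.Pointwise.Inductive using ([]; _∷_; map⁺)
open import Data.Product using (_,_)
open import Data.Sum using (inj₁; inj₂)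
open import Relation.Nullary using (contradiction)
open import Relation.Binary.PropositionalEquality
  using (_≡_; refl; cong; cong₂; sym; module ≡-Reasoning)

zipWith-natural : ∀ {A B : Set} {k} (h : A → B) (F : A → A → A) (G : B → B → B) →
  (∀ x y → G (h x) (h y) ≡ h (F x y)) → (xs ys : Vec A k) →
  zipWith G (map h xs) (map h ys) ≡ map h (zipWith F xs ys)
zipWith-natural h F G hom []       []       = refl
zipWith-natural h F G hom (x ∷ xs) (y ∷ ys) =
  cong₂ _∷_ (hom x y) (zipWith-natural h F G hom xs ys)

map-natural : ∀ {A B : Set} {k} (h : A → B) (F : A → A) (G : B → B) →
  (∀ x → G (h x) ≡ h (F x)) → (xs : Vec A k) → map G (map h xs) ≡ map h (map F xs)
map-natural h F G hom xs = begin
  map G (map h xs)       ≡⟨ sym (map-∘ G h xs) ⟩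
  map (λ x → G (h x)) xs ≡⟨ map-cong hom xs ⟩
  map (λ x → h (F x)) xs ≡⟨ map-∘ h F xs ⟩
  map h (map F xs)       ∎
  where open ≡-Reasoning

infix 4 _⊏_
data _⊏_ : ∀ {k} → Vec ℕ k → Vec ℕ k → Set where
  here  : ∀ {k x′ x} {xs′ xs : Vec ℕ k} → x′ < x → Pointwise _≤_ xs′ xs → x′ ∷ xs′ ⊏ x ∷ xs
  there : ∀ {k x′ x} {xs′ xs : Vec ℕ k} → x′ ≤ x → xs′ ⊏ xs → x′ ∷ xs′ ⊏ x ∷ xs

≤-≢⇒⊏ : ∀ {k} {a′ a : Vec ℕ k} → Pointwise _≤_ a′ a → a′ ≢ a → a′ ⊏ a
≤-≢⇒⊏ []                         a′≢a = contradiction refl a′≢a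
≤-≢⇒⊏ {a = x ∷ _} (x′≤x ∷ xs′≤xs) a′≢a with m≤n⇒m<n∨m≡n x′≤x
... | inj₁ x′<x  = here x′<x xs′≤xs
... | inj₂ refl  = there x′≤x (≤-≢⇒⊏ xs′≤xs (λ xs′≡xs → a′≢a (cong (x ∷_) xs′≡xs)))

zipWith-mono : ∀ {k} {f′ f : ℕ → ℕ → ℕ} →
  (∀ {x′ x y′ y} → x′ ≤ x → y′ ≤ y → f′ x′ y′ ≤ f x y) →
  {xs′ xs ys′ ys : Vec ℕ k} → Pointwise _≤_ xs′ xs → Pointwise _≤_ ys′ ys →
  Pointwise _≤_ (zipWith f′ xs′ ys′) (zipWith f xs ys)
zipWith-mono mono []               []               = []
zipWith-mono mono (x′≤x ∷ xs′≤xs) (y′≤y ∷ ys′≤ys) =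
  mono x′≤x y′≤y ∷ zipWith-mono mono xs′≤xs ys′≤ys

zipWith-⊏ : ∀ {k} {f′ f : ℕ → ℕ → ℕ} →
  (∀ {x′ x y′ y} → x′ ≤ x → y′ ≤ y → f′ x′ y′ ≤ f x y) →
  (∀ {x′ x y′ y} → x′ < x → y′ ≤ y → f′ x′ y′ < f x y) →
  {xs′ xs ys′ ys : Vec ℕ k} → xs′ ⊏ xs → Pointwise _≤_ ys′ ys →
  zipWith f′ xs′ ys′ ⊏ zipWith f xs ys
zipWith-⊏ mono strict (here x′<x xs′≤xs)  (y′≤y ∷ ys′≤ys) =
  here (strict x′<x y′≤y) (zipWith-mono mono xs′≤xs ys′≤ys)
zipWith-⊏ mono strict (there x′≤x xs′⊏xs) (y′≤y ∷ ys′≤ys) =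
  there (mono x′≤x y′≤y) (zipWith-⊏ mono strict xs′⊏xs ys′≤ys)

module _ (m r : ℕ) where

  step-b : ℕ → ℕ → ℕ
  step-b a₀ b = b + a₀ * m

  step-a : ℕ → ℕ → ℕ → ℕ
  step-a a₀ a b = a + suc r * step-b a₀ b * a₀

  measureℕ : (n : ℕ) → Vec ℕ (suc n) → Vec ℕ (suc n) → ℕ
  measureℕ zero    (a₀ ∷ [])  (b₀ ∷ [])  = a₀
  measureℕ (suc n) (a₀ ∷ as) (b₀ ∷ bs) =
    measureℕ n (zipWith (step-a a₀) as bs) (map (step-b a₀) bs)

  step-b-cast : ∀ a₀ b → + b ℤ.+ + a₀ ℤ.* + m ≡ + step-b a₀ b
  step-b-cast a₀ b = begin
    + b ℤ.+ + a₀ ℤ.* + m   ≡⟨ cong (ℤ._+_ (+ b)) (sym (pos-* a₀ m)) ⟩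
    + b ℤ.+ + (a₀ * m)     ≡⟨ sym (pos-+ b (a₀ * m)) ⟩
    + step-b a₀ b          ∎
    where open ≡-Reasoning

  step-a-cast : ∀ a₀ a b →
    + a ℤ.+ + suc r ℤ.* (+ b ℤ.+ + a₀ ℤ.* + m) ℤ.* + a₀ ≡ + step-a a₀ a b
  step-a-cast a₀ a b = begin
    + a ℤ.+ + suc r ℤ.* (+ b ℤ.+ + a₀ ℤ.* + m) ℤ.* + a₀
      ≡⟨ cong (λ t → + a ℤ.+ + suc r ℤ.* t ℤ.* + a₀) (step-b-cast a₀ b) ⟩
    + a ℤ.+ + suc r ℤ.* + step-b a₀ b ℤ.* + a₀
      ≡⟨ cong (λ t → + a ℤ.+ t ℤ.* + a₀) (sym (pos-* (suc r) (step-b a₀ b))) ⟩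
    + a ℤ.+ + (suc r * step-b a₀ b) ℤ.* + a₀
      ≡⟨ cong (ℤ._+_ (+ a)) (sym (pos-* (suc r * step-b a₀ b) a₀)) ⟩
    + a ℤ.+ + (suc r * step-b a₀ b * a₀)
      ≡⟨ sym (pos-+ a (suc r * step-b a₀ b * a₀)) ⟩
    + step-a a₀ a b ∎
    where open ≡-Reasoning

  measure-cast : ∀ n (a b : Vec ℕ (suc n)) →
    measure m r n (map +_ a) (map +_ b) ≡ + measureℕ n a b
  measure-cast zero    (a₀ ∷ [])  (b₀ ∷ [])  = refl
  measure-cast (suc n) (a₀ ∷ as) (b₀ ∷ bs) = begin
    measure m r (suc n) (map +_ (a₀ ∷ as)) (map +_ (b₀ ∷ bs))
      ≡⟨ cong₂ (measure m r n) (zipWith-natural +_ (step-a a₀) _ (step-a-cast a₀) as bs)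
                                (map-natural +_ (step-b a₀) _ (step-b-cast a₀) bs) ⟩
    measure m r n (map +_ (zipWith (step-a a₀) as bs)) (map +_ (map (step-b a₀) bs))
      ≡⟨ measure-cast n (zipWith (step-a a₀) as bs) (map (step-b a₀) bs) ⟩
    + measureℕ (suc n) (a₀ ∷ as) (b₀ ∷ bs) ∎
    where open ≡-Reasoning

  step-b-mono : ∀ {a₀′ a₀ b′ b} → a₀′ ≤ a₀ → b′ ≤ b → step-b a₀′ b′ ≤ step-b a₀ b
  step-b-mono a₀′≤a₀ b′≤b = +-mono-≤ b′≤b (*-monoˡ-≤ m a₀′≤a₀)

  increment-mono : ∀ {a₀′ a₀ b′ b} → a₀′ ≤ a₀ → b′ ≤ b →
    suc r * step-b a₀′ b′ * a₀′ ≤ suc r * step-b a₀ b * a₀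
  increment-mono a₀′≤a₀ b′≤b =
    *-mono-≤ (*-monoʳ-≤ (suc r) (step-b-mono a₀′≤a₀ b′≤b)) a₀′≤a₀

  -- For m ≥ 1 the increment is strictly monotone in a₀: its factor
  -- (r+1)·(b + a₀·m) is positive as soon as a₀ is.
  increment-strict : m ≥ 1 → ∀ {a₀′ a₀ b′ b} → a₀′ < a₀ → b′ ≤ b →
    suc r * step-b a₀′ b′ * a₀′ < suc r * step-b a₀ b * a₀
  increment-strict m≥1 {a₀′} {a₀} {b′} {b} a₀′<a₀ b′≤b = begin-strict
    suc r * step-b a₀′ b′ * a₀′ ≤⟨ *-monoˡ-≤ a₀′ (*-monoʳ-≤ (suc r) (step-b-mono (<⇒≤ a₀′<a₀) b′≤b)) ⟩
    factor * a₀′                <⟨ *-monoʳ-< factor {{>-nonZero factor-pos}} a₀′<a₀ ⟩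
    factor * a₀                 ∎
    where
    open ≤-Reasoning
    factor : ℕ
    factor = suc r * step-b a₀ b
    factor-pos : 0 < factor
    factor-pos = ≤-trans (*-mono-≤ (≤-trans (s≤s z≤n) a₀′<a₀) m≥1)
                   (≤-trans (m≤n+m (a₀ * m) b) (m≤n*m (step-b a₀ b) (suc r)))

  step-a-mono : ∀ {a₀′ a₀ a′ a b′ b} → a₀′ ≤ a₀ → a′ ≤ a → b′ ≤ b →
    step-a a₀′ a′ b′ ≤ step-a a₀ a b
  step-a-mono a₀′≤a₀ a′≤a b′≤b = +-mono-≤ a′≤a (increment-mono a₀′≤a₀ b′≤b)

  step-a-strict : ∀ {a₀′ a₀ a′ a b′ b} → a₀′ ≤ a₀ → a′ < a → b′ ≤ b →
    step-a a₀′ a′ b′ < step-a a₀ a b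
  step-a-strict a₀′≤a₀ a′<a b′≤b = +-mono-<-≤ a′<a (increment-mono a₀′≤a₀ b′≤b)

  step-a-strict₀ : m ≥ 1 → ∀ {a₀′ a₀ a′ a b′ b} → a₀′ < a₀ → a′ ≤ a → b′ ≤ b →
    step-a a₀′ a′ b′ < step-a a₀ a b
  step-a-strict₀ m≥1 a₀′<a₀ a′≤a b′≤b = +-mono-≤-< a′≤a (increment-strict m≥1 a₀′<a₀ b′≤b)

  measureℕ-mono : ∀ n {a′ a b′ b : Vec ℕ (suc n)} →
    Pointwise _≤_ a′ a → Pointwise _≤_ b′ b → measureℕ n a′ b′ ≤ measureℕ n a b
  measureℕ-mono zero    (a₀′≤a₀ ∷ []) (_ ∷ []) = a₀′≤a₀
  measureℕ-mono (suc n) (a₀′≤a₀ ∷ as′≤as) (_ ∷ bs′≤bs) =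
    measureℕ-mono n (zipWith-mono (step-a-mono a₀′≤a₀) as′≤as bs′≤bs)
                    (map⁺ (step-b-mono a₀′≤a₀) bs′≤bs)

  -- For m ≥ 1, measureℕ is strictly monotone in its first vector: a strict drop
  -- in the head becomes one in the new head, a later strict drop stays in place.
  measureℕ-strict : m ≥ 1 → ∀ n {a′ a b′ b : Vec ℕ (suc n)} →
    a′ ⊏ a → Pointwise _≤_ b′ b → measureℕ n a′ b′ < measureℕ n a b
  measureℕ-strict m≥1 zero    (here a₀′<a₀ []) (_ ∷ []) = a₀′<a₀
  measureℕ-strict m≥1 zero    (there _ ())     _
  measureℕ-strict m≥1 (suc n) (here a₀′<a₀ (a₁′≤a₁ ∷ as′≤as)) (_ ∷ b₁′≤b₁ ∷ bs′≤bs) =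
    measureℕ-strict m≥1 n
      (here (step-a-strict₀ m≥1 a₀′<a₀ a₁′≤a₁ b₁′≤b₁)
            (zipWith-mono (step-a-mono (<⇒≤ a₀′<a₀)) as′≤as bs′≤bs))
      (map⁺ (step-b-mono (<⇒≤ a₀′<a₀)) (b₁′≤b₁ ∷ bs′≤bs))
  measureℕ-strict m≥1 (suc n) (there a₀′≤a₀ as′⊏as) (_ ∷ bs′≤bs) =
    measureℕ-strict m≥1 n
      (zipWith-⊏ (step-a-mono a₀′≤a₀) (step-a-strict a₀′≤a₀) as′⊏as bs′≤bs)
      (map⁺ (step-b-mono a₀′≤a₀) bs′≤bs)

lemma8 : (m r : ℕ) → m ≥ 1 → (n : ℕ) → (a b a′ b′ : Vec ℕ (suc n)) →
    Pointwise _≤_ a′ a → Pointwise _≤_ b′ b →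
    (measure m r n (map +_ a′) (map +_ b′) ≤ℤ measure m r n (map +_ a) (map +_ b))
    × (a′ ≢ a → measure m r n (map +_ a′) (map +_ b′) <ℤ measure m r n (map +_ a) (map +_ b))
lemma8 m r m≥1 n a b a′ b′ a′≤a b′≤b
  rewrite measure-cast m r n a b | measure-cast m r n a′ b′ =
    ℤ.+≤+ (measureℕ-mono m r n a′≤a b′≤b) ,
    λ a′≢a → ℤ.+<+ (measureℕ-strict m r m≥1 n (≤-≢⇒⊏ a′≤a a′≢a) b′≤b)
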